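{- Let $n\ge1$, $D_\pi\in W(n)$, and $Y_2=\{1\le i\le n:\pi(i)=-1\}$. Then $$R^{(W(n))}_{D_\pi,D_\pi}=\sum_{k}\frac{(-1)^{k-1}}{k}\sum_{A\subseteq Y_2,\;B\subseteq\{1,\dots,n\}\setminus Y_2}\mathsf{wordeuler}_{n,k}\big(A,\;\{1,\dots,n\}\setminus(A\cup B),\;B\big).$$
   Context: A 4-tuple $(x,y,a,b)$ is an edge from peg $x$ at height $a$ to peg $y$ at height $b$ (height 1 = bottom). $W(n)$ is the set (a web world) of web diagrams on $n+2$ pegs $D=\{e_i=(i,i+1,x_i,y_{i+1}):1\le i\le n+1\}$ with $x_1=y_{n+2}=1$ and $\{x_i,y_i\}=\{1,2\}$ for $2\le i\le n+1$. $D$ is encoded by $\pi\in\{+1,-1\}^n$ with $\pi(i)=+1$ if $y_{i+1}=1,x_{i+1}=2$ and $\pi(i)=-1$ if $y_{i+1}=2,x_{i+1}=1$; write $D_\pi$. Reconstruction: $D\oplus D'=D\cup\{(x',y',a'+p_{x'}(D),b'+p_{y'}(D)):(x',y',a',b')\in D'\}$, $p_i(D)$ the number of endpoints of $D$ on peg $i$; $\mathrm{rel}(X)$ relabels heights of endpoints of edges of $X$ on each peg by $1,\dots,\ell_i$ preserving relative order; a $k$-colouring is a surjection $c$ from edges onto $\{1,\dots,k\}$ and $\mathcal{R}(D,c)=\mathrm{rel}(D_c(1))\oplus\cdots\oplus\mathrm{rel}(D_c(k))$. $f(D_1,D_2,\ell)$ is the number of $\ell$-colourings $c$ of $D_1$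 with $\mathcal{R}(D_1,c)=D_2$ and $R^{(W)}_{D_1,D_2}=\sum_{\ell\ge1}\frac{(-1)^{\ell-1}}{\ell}f(D_1,D_2,\ell)$. $\mathcal{C}_{n+1,k}$ is the set of sequences $(c(1),\dots,c(n+1))$ using exactly the colours $1,\dots,k$. For $c\in\mathcal{C}_{n+1,k}$: $\mathrm{Des}(c)=\{1\le i\le n:c(i)>c(i+1)\}$, $\mathrm{Equ}(c)=\{1\le i\le n:c(i)=c(i+1)\}$, $\mathrm{Asc}(c)=\{1\le i\le n:c(i)<c(i+1)\}$; $\mathsf{wordeuler}_{n,k}(X_1,X_2,X_3)$ is the number of $c\in\mathcal{C}_{n+1,k}$ with $(\mathrm{Des}(c),\mathrm{Equ}(c),\mathrm{Asc}(c))=(X_1,X_2,X_3)$. -}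

module Defs where

open import Data.Nat using (ℕ; zero; suc; _+_; _<ᵇ_; _≡ᵇ_)
open import Data.Bool using (Bool; true; false; _∧_; not; if_then_else_)
open import Data.List using (List; []; _∷_; map; concatMap; foldl; upTo; allFin; _++_; zip; filter; length)
open import Data.Bool.ListAction using (all; any)
import Data.Nat.ListAction
open import Data.Vec using (Vec; []; _∷_; toList; lookup)
open import Data.Fin using (Fin; toℕ)
open import Data.Fin.Subset using (Subset; ∁; _∪_)
open import Data.Sign using (Sign) renaming (+ to plus; - to minus)
open import Data.Product using (_×_; _,_; proj₁; proj₂)
open import Data.Integer using (ℤ; +_; -_)
import Data.Integer as ℤ
open import Data.Rational using (ℚ; 0ℚ; _/_)
import Data.Rational as ℚ

count : {A : Set} → (A → Bool) → List A → ℕ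
count p []       = 0
count p (x ∷ xs) = if p x then suc (count p xs) else count p xs

allVecs : {A : Set} → List A → (m : ℕ) → List (Vec A m)
allVecs xs zero    = [] ∷ []
allVecs xs (suc m) = concatMap (λ a → map (a ∷_) (allVecs xs m)) xs

-- sum of f ℓ over ℓ = 1 .. N  (f receives ℓ - 1)
sumℚ : ℕ → (ℕ → ℚ) → ℚ
sumℚ zero    f = 0ℚ
sumℚ (suc N) f = sumℚ N f ℚ.+ f N

negOnePow : ℕ → ℤ
negOnePow zero    = + 1
negOnePow (suc m) = - negOnePow m

-- ((-1)^(ℓ-1) / ℓ) * v, where ℓ = suc ℓ'
signedTerm : ℕ → ℕ → ℚ
signedTerm ℓ' v = (negOnePow ℓ' ℤ.* (+ v)) / suc ℓ'

-- Edges and web diagrams.  An edge (x , y , a , b) goes from peg x at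
-- height a to peg y at height b.  A diagram is a finite set of edges,
-- represented by a list (compared as sets, see sameSet).

Edge : Set
Edge = ℕ × ℕ × ℕ × ℕ

edgeEqᵇ : Edge → Edge → Bool
edgeEqᵇ (x , y , a , b) (x' , y' , a' , b') =
  (x ≡ᵇ x') ∧ ((y ≡ᵇ y') ∧ ((a ≡ᵇ a') ∧ (b ≡ᵇ b')))

memᵇ : Edge → List Edge → Bool
memᵇ e D = any (edgeEqᵇ e) D

sameSet : List Edge → List Edge → Bool
sameSet D E = all (λ e → memᵇ e E) D ∧ all (λ e → memᵇ e D) E

-- endpoints (peg , height)
endpoints : List Edge → List (ℕ × ℕ)
endpoints = concatMap (λ e → (proj₁ e , proj₁ (proj₂ (proj₂ e)))
                           ∷ (proj₁ (proj₂ e) , proj₂ (proj₂ (proj₂ e))) ∷ [])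

pegCount : ℕ → List Edge → ℕ
pegCount i D = count (λ q → proj₁ q ≡ᵇ i) (endpoints D)

_⊕_ : List Edge → List Edge → List Edge
D ⊕ D' = D ++ map (λ { (x , y , a , b) → (x , y , a + pegCount x D , b + pegCount y D) }) D'

occupied : List Edge → ℕ → ℕ → Bool
occupied X i h = any (λ q → (proj₁ q ≡ᵇ i) ∧ (proj₂ q ≡ᵇ h)) (endpoints X)

-- new height of an endpoint of X on peg i at height h:
-- 1 + number of distinct occupied heights on peg i below h
rank : List Edge → ℕ → ℕ → ℕ
rank X i h = suc (count (λ h' → (h' <ᵇ h) ∧ occupied X i h') (upTo h))

rel : List Edge → List Edge
rel X = map (λ { (x , y , a , b) → (x , y , rank X x a , rank X y b) }) X

-- Colourings of a diagram D (edges in list order): vectors of colours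
-- in Fin ℓ (colour j+1 of the paper is Fin element j), surjective.

surjᵇ : {ℓ m : ℕ} → Vec (Fin ℓ) m → Bool
surjᵇ {ℓ} c = all (λ j → any (λ c' → toℕ c' ≡ᵇ toℕ j) (toList c)) (allFin ℓ)

colourClass : {ℓ : ℕ} (D : List Edge) → Vec (Fin ℓ) (length D) → Fin ℓ → List Edge
colourClass D c j = map proj₁ (filter (λ p → toℕ (proj₂ p) Data.Nat.≟ toℕ j) (zip D (toList c)))

reconstruct : {ℓ : ℕ} (D : List Edge) → Vec (Fin ℓ) (length D) → List Edge
reconstruct {ℓ} D c = foldl _⊕_ [] (map (λ j → rel (colourClass D c j)) (allFin ℓ))

fCount : List Edge → List Edge → ℕ → ℕ
fCount D1 D2 ℓ =
  count (λ c → surjᵇ c ∧ sameSet (reconstruct D1 c) D2) (allVecs (allFin ℓ) (length D1))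

-- R^{(W)}_{D1,D2} = Σ_{ℓ ≥ 1} (-1)^{ℓ-1}/ℓ f(D1,D2,ℓ); terms with
-- ℓ > |D1| vanish (no surjection), so the sum is taken over 1 ≤ ℓ ≤ |D1|.
Rcoef : List Edge → List Edge → ℚ
Rcoef D1 D2 = sumℚ (length D1) (λ ℓ' → signedTerm ℓ' (fCount D1 D2 (suc ℓ')))

-- The web diagram D_π ∈ W(n), π ∈ {+1,-1}^n as Vec Sign n
-- (π(i) is the entry at 0-based position i-1).

signAt : List Sign → ℕ → Sign
signAt []       _       = plus
signAt (s ∷ _)  zero    = s
signAt (_ ∷ ss) (suc m) = signAt ss m

-- x_i (1-based i, 1 ≤ i ≤ n+1)
xCoord : {n : ℕ} → Vec Sign n → ℕ → ℕ
xCoord π zero          = 1   -- unused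
xCoord π (suc zero)    = 1
xCoord π (suc (suc m)) with signAt (toList π) m
... | plus  = 2
... | minus = 1

-- y_j (1-based j, 2 ≤ j ≤ n+2)
yCoord : {n : ℕ} → Vec Sign n → ℕ → ℕ
yCoord π zero          = 1   -- unused
yCoord π (suc zero)    = 1   -- unused
yCoord {n} π (suc (suc m)) =
  if m ≡ᵇ n then 1 else yS (signAt (toList π) m)
  where
  yS : Sign → ℕ
  yS plus  = 1
  yS minus = 2

-- D_π = { e_i = (i , i+1 , x_i , y_{i+1}) : 1 ≤ i ≤ n+1 }
webDiagram : {n : ℕ} → Vec Sign n → List Edge
webDiagram {n} π =
  map (λ j → (suc j , suc (suc j) , xCoord π (suc j) , yCoord π (suc (suc j)))) (upTo (suc n))

-- Words and wordeuler.  Subsets of {1..n} are Subset n (position i-1 ↔ i).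

pairSet : {k n : ℕ} → (ℕ → ℕ → Bool) → Vec (Fin k) (suc n) → Subset n
pairSet r (a ∷ [])         = []
pairSet r (a ∷ (b ∷ rest)) = r (toℕ a) (toℕ b) ∷ pairSet r (b ∷ rest)

Des Equ Asc : {k n : ℕ} → Vec (Fin k) (suc n) → Subset n
Des = pairSet (λ a b → b <ᵇ a)
Equ = pairSet (λ a b → a ≡ᵇ b)
Asc = pairSet (λ a b → a <ᵇ b)

subsetEqᵇ : {n : ℕ} → Subset n → Subset n → Bool
subsetEqᵇ []       []       = true
subsetEqᵇ (x ∷ xs) (y ∷ ys) = (if x then y else not y) ∧ subsetEqᵇ xs ys

subsetLeqᵇ : {n : ℕ} → Subset n → Subset n → Bool
subsetLeqᵇ []       []       = true
subsetLeqᵇ (x ∷ xs) (y ∷ ys) = (if x then y else true) ∧ subsetLeqᵇ xs ys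

-- wordeuler_{n,k}(X1,X2,X3); words in C_{n+1,k} are surjective
-- c : Vec (Fin k) (n+1) (colour j+1 ↔ Fin element j, order preserved)
wordeuler : (n k : ℕ) → Subset n → Subset n → Subset n → ℕ
wordeuler n k X1 X2 X3 =
  count (λ c → surjᵇ c ∧ (subsetEqᵇ (Des c) X1 ∧ (subsetEqᵇ (Equ c) X2 ∧ subsetEqᵇ (Asc c) X3)))
        (allVecs (allFin k) (suc n))

Y2 : {n : ℕ} → Vec Sign n → Subset n
Y2 [] = []
Y2 (plus ∷ π)  = false ∷ Y2 π
Y2 (minus ∷ π) = true ∷ Y2 π

allSubsets : (n : ℕ) → List (Subset n)
allSubsets n = allVecs (true ∷ false ∷ []) n

innerSum : (n k : ℕ) → Vec Sign n → ℕ
innerSum n k π =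
  Data.Nat.ListAction.sum (concatMap (λ A → map (λ B → wordeuler n k A (∁ (A ∪ B)) B)
                                     (filter (λ B → Data.Bool._≟_ (subsetLeqᵇ B (∁ (Y2 π))) true) (allSubsets n)))
                     (filter (λ A → Data.Bool._≟_ (subsetLeqᵇ A (Y2 π)) true) (allSubsets n)))

-- Σ_k (-1)^{k-1}/k · innerSum; terms with k > n+1 vanish
-- (no surjective word of length n+1 onto k > n+1 colours).
rhs : (n : ℕ) → Vec Sign n → ℚ
rhs n π = sumℚ (suc n) (λ k' → signedTerm k' (innerSum n (suc k') π))

module Submission where

-- Both sides are the same signed sum over k, so it suffices to show, for each
-- number of colours k, that f(D_π, D_π, k) equals the inner double sum.  Both
-- count the surjective words c of length n+1 over k colours that are compatible
-- with π: c(i) ≤ c(i+1) where π(i) = +1 and c(i) ≥ c(i+1) where π(i) = −1.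
--
--  * Words: since Equ c = ∁ (Des c ∪ Asc c), the double sum counts each word
--    once, for A = Des c and B = Asc c, provided Des c ⊆ Y₂ and Asc c ∩ Y₂ = ∅.
--  * Reconstruction (any diagram): R(D, c) consists of the edges of D with every
--    endpoint lifted to its rank inside its colour class plus the number of
--    endpoints on that peg of edges of smaller colour.
--  * Web diagrams: every inner peg of D_π carries two endpoints at heights 1, 2,
--    and both keep their heights iff the colour of the lower one is at most the
--    colour of the upper one; the outer pegs carry one endpoint each.  Hence
--    R(D_π, c) = D_π iff c is compatible with π.

open import Defs
open import Data.Bool using (Bool; true; false; _∧_; _∨_; not; if_then_else_; T)
import Data.Bool
open import Data.Bool.ListAction using (all; any)
open import Data.Bool.Properties using (T-≡; T-∧; ∨-identityʳ; ∧-zeroʳ; ∧-identityʳ)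
open import Data.Empty using (⊥-elim)
open import Data.Fin using (Fin; toℕ)
import Data.Fin as Fin
open import Data.Fin.Properties using (toℕ-injective; toℕ<n)
open import Data.Fin.Subset using (Subset; ∁; _∪_)
open import Data.List using (List; []; _∷_; map; concatMap; _++_; filter; allFin; foldl; zip; length; tabulate; applyUpTo; upTo)
open import Data.List.Membership.Propositional using (_∈_)
open import Data.List.Membership.Propositional.Properties using (∈-applyUpTo⁺; ∈-applyUpTo⁻; ∈-upTo⁺; ∈-upTo⁻; ∈-map⁺; ∈-map⁻; ∈-++⁺ˡ; ∈-++⁺ʳ; ∈-++⁻; ∈-filter⁺; ∈-filter⁻)
open import Data.List.Properties using (length-map; length-upTo)
import Data.List.Relation.Unary.All as All
open import Data.List.Relation.Unary.All.Properties using (all⁺; all⁻)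
import Data.List.Relation.Unary.Any as Any
open import Data.List.Relation.Unary.Any.Properties using (any⁺; any⁻)
open import Data.Nat using (ℕ; zero; suc; _+_; _≤_; _<_; z≤n; s≤s; _<ᵇ_; _≡ᵇ_)
open import Data.Nat.ListAction using (sum)
open import Data.Nat.ListAction.Properties using (sum-++)
open import Data.Nat.Properties using (n<1+n; m≤n⇒m<n∨m≡n; m<n⇒m<1+n; suc-injective; ≡ᵇ⇒≡; ≡⇒≡ᵇ; <⇒<ᵇ; +-assoc; +-identityʳ; +-suc; _<?_; ≤-antisym; ≤-pred; ≮⇒≥; +-commutativeSemigroup)
open import Algebra.Properties.CommutativeSemigroup +-commutativeSemigroup using (interchange)
open import Data.Product using (_×_; _,_; proj₁; proj₂; ∃)
open import Data.Product.Function.NonDependent.Propositional using (_×-⇔_)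
open import Data.Rational using (ℚ)
import Data.Rational as ℚ
open import Data.Sign using (Sign) renaming (+ to plus; - to minus)
open import Data.Sum using (inj₁; inj₂)
open import Data.Unit using (tt)
open import Data.Vec using (Vec; []; _∷_; toList)
open import Data.Vec.Properties using (length-toList)
open import Function using (_∘_; _⇔_; mk⇔; Equivalence)
open import Function.Construct.Composition using (_⇔-∘_)
open import Function.Construct.Identity using (⇔-id)
open import Function.Construct.Symmetry using (⇔-sym)
open import Function.Properties.Equivalence using (⇔-setoid)
open import Level using (0ℓ)
import Relation.Binary.Reasoning.Setoid as SetoidReasoning
open import Relation.Binary.PropositionalEquality
open import Relation.Nullary using (does; yes; no)
open import Relation.Unary using (Decidable)

ind : Bool → ℕ
ind b = if b then 1 else 0

sumOver : {A : Set} → (A → ℕ) → List A → ℕ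
sumOver f []       = 0
sumOver f (x ∷ xs) = f x + sumOver f xs

count≡sumOver : {A : Set} (p : A → Bool) (xs : List A) → count p xs ≡ sumOver (ind ∘ p) xs
count≡sumOver p [] = refl
count≡sumOver p (x ∷ xs) with p x
... | true  = cong suc (count≡sumOver p xs)
... | false = count≡sumOver p xs

sumOver-cong : {A : Set} {f g : A → ℕ} → (∀ x → f x ≡ g x) → (xs : List A) → sumOver f xs ≡ sumOver g xs
sumOver-cong f≡g []       = refl
sumOver-cong f≡g (x ∷ xs) = cong₂ _+_ (f≡g x) (sumOver-cong f≡g xs)

count-cong : {A : Set} {p q : A → Bool} → (∀ x → p x ≡ q x) → (xs : List A) → count p xs ≡ count q xs
count-cong {p = p} {q} p≡q xs = begin
  count p xs              ≡⟨ count≡sumOver p xs ⟩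
  sumOver (ind ∘ p) xs    ≡⟨ sumOver-cong (cong ind ∘ p≡q) xs ⟩
  sumOver (ind ∘ q) xs    ≡⟨ count≡sumOver q xs ⟨
  count q xs              ∎
  where open ≡-Reasoning

sumOver-zero : {A : Set} (xs : List A) → sumOver (λ _ → 0) xs ≡ 0
sumOver-zero []       = refl
sumOver-zero (x ∷ xs) = sumOver-zero xs

sumOver-+ : {A : Set} (f g : A → ℕ) (xs : List A) →
  sumOver (λ x → f x + g x) xs ≡ sumOver f xs + sumOver g xs
sumOver-+ f g []       = refl
sumOver-+ f g (x ∷ xs) =
  trans (cong (f x + g x +_) (sumOver-+ f g xs)) (interchange (f x) (g x) _ _)

sumOver-++ : {A : Set} (f : A → ℕ) (xs ys : List A) → sumOver f (xs ++ ys) ≡ sumOver f xs + sumOver f ys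
sumOver-++ f []       ys = refl
sumOver-++ f (x ∷ xs) ys = trans (cong (f x +_) (sumOver-++ f xs ys)) (sym (+-assoc (f x) _ _))

sumOver-map : {A B : Set} (f : B → ℕ) (g : A → B) (xs : List A) → sumOver f (map g xs) ≡ sumOver (f ∘ g) xs
sumOver-map f g []       = refl
sumOver-map f g (x ∷ xs) = cong (f (g x) +_) (sumOver-map f g xs)

sumOver-swap : {A B : Set} (F : A → B → ℕ) (xs : List A) (ys : List B) →
  sumOver (λ a → sumOver (F a) ys) xs ≡ sumOver (λ b → sumOver (λ a → F a b) xs) ys
sumOver-swap F []       ys = sym (sumOver-zero ys)
sumOver-swap F (x ∷ xs) ys = begin
  sumOver (F x) ys + sumOver (λ a → sumOver (F a) ys) xs
    ≡⟨ cong (sumOver (F x) ys +_) (sumOver-swap F xs ys) ⟩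
  sumOver (F x) ys + sumOver (λ b → sumOver (λ a → F a b) xs) ys
    ≡⟨ sumOver-+ (F x) (λ b → sumOver (λ a → F a b) xs) ys ⟨
  sumOver (λ b → F x b + sumOver (λ a → F a b) xs) ys ∎
  where open ≡-Reasoning

sumOver-filter : {A : Set} {P : A → Set} (P? : Decidable P) (f : A → ℕ) (xs : List A) →
  sumOver f (filter P? xs) ≡ sumOver (λ x → if does (P? x) then f x else 0) xs
sumOver-filter P? f [] = refl
sumOver-filter P? f (x ∷ xs) with does (P? x)
... | true  = cong (f x +_) (sumOver-filter P? f xs)
... | false = sumOver-filter P? f xs

sum-concatMap : {A : Set} (g : A → List ℕ) (xs : List A) →
  sum (concatMap g xs) ≡ sumOver (sum ∘ g) xs
sum-concatMap g []       = refl
sum-concatMap g (x ∷ xs) = trans (sum-++ (g x) _) (cong (sum (g x) +_) (sum-concatMap g xs))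

sum-map : {A : Set} (f : A → ℕ) (xs : List A) → sum (map f xs) ≡ sumOver f xs
sum-map f []       = refl
sum-map f (x ∷ xs) = cong (f x +_) (sum-map f xs)

subsetEqᵇ-sound : {n : ℕ} (S B : Subset n) → subsetEqᵇ S B ≡ true → S ≡ B
subsetEqᵇ-sound []          []          _ = refl
subsetEqᵇ-sound (true ∷ S)  (true ∷ B)  e = cong (true ∷_) (subsetEqᵇ-sound S B e)
subsetEqᵇ-sound (false ∷ S) (false ∷ B) e = cong (false ∷_) (subsetEqᵇ-sound S B e)
subsetEqᵇ-sound (true ∷ S)  (false ∷ B) ()
subsetEqᵇ-sound (false ∷ S) (true ∷ B)  ()

sumOver-allSubsets-suc : (n : ℕ) (F : Subset (suc n) → ℕ) →
  sumOver F (allSubsets (suc n)) ≡ sumOver (F ∘ (true ∷_)) (allSubsets n) + sumOver (F ∘ (false ∷_)) (allSubsets n)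
sumOver-allSubsets-suc n F = begin
  sumOver F (map (true ∷_) L ++ map (false ∷_) L ++ [])
    ≡⟨ sumOver-++ F (map (true ∷_) L) _ ⟩
  sumOver F (map (true ∷_) L) + sumOver F (map (false ∷_) L ++ [])
    ≡⟨ cong (sumOver F (map (true ∷_) L) +_) (trans (sumOver-++ F (map (false ∷_) L) []) (+-identityʳ _)) ⟩
  sumOver F (map (true ∷_) L) + sumOver F (map (false ∷_) L)
    ≡⟨ cong₂ _+_ (sumOver-map F (true ∷_) L) (sumOver-map F (false ∷_) L) ⟩
  sumOver (F ∘ (true ∷_)) L + sumOver (F ∘ (false ∷_)) L ∎
  where
  open ≡-Reasoning
  L : List (Subset n)
  L = allSubsets n

sumOver-δ : (n : ℕ) (S : Subset n) (G : Subset n → ℕ) →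
  sumOver (λ B → if subsetEqᵇ S B then G B else 0) (allSubsets n) ≡ G S
sumOver-δ zero    []      G = +-identityʳ (G [])
sumOver-δ (suc n) (s ∷ S) G =
  trans (sumOver-allSubsets-suc n (λ B → if subsetEqᵇ (s ∷ S) B then G B else 0)) (split s)
  where
  δ-rest : (b : Bool) → sumOver (λ B → if subsetEqᵇ S B then G (b ∷ B) else 0) (allSubsets n) ≡ G (b ∷ S)
  δ-rest b = sumOver-δ n S (G ∘ (b ∷_))
  split : (s : Bool) →
    sumOver (λ B → if subsetEqᵇ (s ∷ S) (true ∷ B) then G (true ∷ B) else 0) (allSubsets n)
    + sumOver (λ B → if subsetEqᵇ (s ∷ S) (false ∷ B) then G (false ∷ B) else 0) (allSubsets n)
    ≡ G (s ∷ S)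
  split true  = trans (cong₂ _+_ (δ-rest true) (sumOver-zero (allSubsets n))) (+-identityʳ _)
  split false = cong₂ _+_ (sumOver-zero (allSubsets n)) (δ-rest false)

sumOver-δ-filter : (n : ℕ) (S : Subset n) {P : Subset n → Set} (P? : Decidable P) (v : ℕ) →
  sumOver (λ B → if subsetEqᵇ S B then v else 0) (filter P? (allSubsets n)) ≡ (if does (P? S) then v else 0)
sumOver-δ-filter n S P? v = begin
  sumOver (λ B → if subsetEqᵇ S B then v else 0) (filter P? (allSubsets n))
    ≡⟨ sumOver-filter P? _ (allSubsets n) ⟩
  sumOver (λ B → if does (P? B) then (if subsetEqᵇ S B then v else 0) else 0) (allSubsets n)
    ≡⟨ sumOver-cong (λ B → if-swap (does (P? B)) (subsetEqᵇ S B)) (allSubsets n) ⟩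
  sumOver (λ B → if subsetEqᵇ S B then (if does (P? B) then v else 0) else 0) (allSubsets n)
    ≡⟨ sumOver-δ n S (λ B → if does (P? B) then v else 0) ⟩
  (if does (P? S) then v else 0) ∎
  where
  open ≡-Reasoning
  if-swap : (a b : Bool) → (if a then (if b then v else 0) else 0) ≡ (if b then (if a then v else 0) else 0)
  if-swap true  true  = refl
  if-swap true  false = refl
  if-swap false true  = refl
  if-swap false false = refl

-- Every position of a word is exactly one of a descent, a level, an ascent:
-- Equ c = ∁ (Des c ∪ Asc c).
Equ≡∁Des∪Asc : {k n : ℕ} (c : Vec (Fin k) (suc n)) → subsetEqᵇ (Equ c) (∁ (Des c ∪ Asc c)) ≡ true
Equ≡∁Des∪Asc (a ∷ [])       = refl
Equ≡∁Des∪Asc (a ∷ b ∷ rest) = cong₂ _∧_ (trichotomy (toℕ a) (toℕ b)) (Equ≡∁Des∪Asc (b ∷ rest))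
  where
  trichotomy : (a b : ℕ) →
    (if a ≡ᵇ b then not ((b <ᵇ a) ∨ (a <ᵇ b)) else not (not ((b <ᵇ a) ∨ (a <ᵇ b)))) ≡ true
  trichotomy zero    zero    = refl
  trichotomy zero    (suc b) = refl
  trichotomy (suc a) zero    = refl
  trichotomy (suc a) (suc b) = trichotomy a b

compatibleᵇ : {k n : ℕ} → Vec Sign n → Vec (Fin k) (suc n) → Bool
compatibleᵇ π c = subsetLeqᵇ (Des c) (Y2 π) ∧ subsetLeqᵇ (Asc c) (∁ (Y2 π))

-- A word is counted by wordeuler(A, ∁(A ∪ B), B) iff Des c = A and Asc c = B
-- (the level set is then forced).
wordeuler-indicator : {k n : ℕ} (c : Vec (Fin k) (suc n)) (A B : Subset n) →
  ind (surjᵇ c ∧ (subsetEqᵇ (Des c) A ∧ (subsetEqᵇ (Equ c) (∁ (A ∪ B)) ∧ subsetEqᵇ (Asc c) B)))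
  ≡ (if subsetEqᵇ (Des c) A then (if subsetEqᵇ (Asc c) B then ind (surjᵇ c) else 0) else 0)
wordeuler-indicator c A B with surjᵇ c | subsetEqᵇ (Des c) A in des≡A | subsetEqᵇ (Asc c) B in asc≡B
... | false | false | _     = refl
... | false | true  | false = refl
... | false | true  | true  = refl
... | true  | false | _     = refl
... | true  | true  | false = cong ind (∧-zeroʳ _)
... | true  | true  | true  = cong (λ b → ind (b ∧ true)) (begin
  subsetEqᵇ (Equ c) (∁ (A ∪ B))
    ≡⟨ cong₂ (λ A B → subsetEqᵇ (Equ c) (∁ (A ∪ B))) (sym (subsetEqᵇ-sound _ _ des≡A)) (sym (subsetEqᵇ-sound _ _ asc≡B)) ⟩
  subsetEqᵇ (Equ c) (∁ (Des c ∪ Asc c))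
    ≡⟨ Equ≡∁Des∪Asc c ⟩
  true ∎)
  where open ≡-Reasoning

-- The inner double sum of the right-hand side counts the surjective words
-- compatible with π: each such word c is counted once, for A = Des c, B = Asc c.
innerSum≡#compatible : (n k : ℕ) (π : Vec Sign n) →
  innerSum n k π ≡ count (λ c → surjᵇ c ∧ compatibleᵇ π c) (allVecs (allFin k) (suc n))
innerSum≡#compatible n k π = begin
  innerSum n k π
    ≡⟨ sum-concatMap _ As ⟩
  sumOver (λ A → sum (map (λ B → wordeuler n k A (∁ (A ∪ B)) B) Bs)) As
    ≡⟨ sumOver-cong (λ A → trans (sum-map _ Bs) (sumOver-cong (λ B → count≡sumOver _ Words) Bs)) As ⟩
  sumOver (λ A → sumOver (λ B → sumOver (counted A B) Words) Bs) As
    ≡⟨ sumOver-cong (λ A → sumOver-swap (counted A) Bs Words) As ⟩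
  sumOver (λ A → sumOver (λ c → sumOver (λ B → counted A B c) Bs) Words) As
    ≡⟨ sumOver-swap (λ A c → sumOver (λ B → counted A B c) Bs) As Words ⟩
  sumOver (λ c → sumOver (λ A → sumOver (λ B → counted A B c) Bs) As) Words
    ≡⟨ sumOver-cong multiplicity Words ⟩
  sumOver (λ c → ind (surjᵇ c ∧ compatibleᵇ π c)) Words
    ≡⟨ count≡sumOver _ Words ⟨
  count (λ c → surjᵇ c ∧ compatibleᵇ π c) Words ∎
  where
  open ≡-Reasoning
  Words : List (Vec (Fin k) (suc n))
  Words = allVecs (allFin k) (suc n)
  inY₂ : Decidable (λ (A : Subset n) → subsetLeqᵇ A (Y2 π) ≡ true)
  inY₂ A = subsetLeqᵇ A (Y2 π) Data.Bool.≟ true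
  outY₂ : Decidable (λ (B : Subset n) → subsetLeqᵇ B (∁ (Y2 π)) ≡ true)
  outY₂ B = subsetLeqᵇ B (∁ (Y2 π)) Data.Bool.≟ true
  As Bs : List (Subset n)
  As = filter inY₂ (allSubsets n)
  Bs = filter outY₂ (allSubsets n)
  counted : Subset n → Subset n → Vec (Fin k) (suc n) → ℕ
  counted A B c = ind (surjᵇ c ∧ (subsetEqᵇ (Des c) A ∧ (subsetEqᵇ (Equ c) (∁ (A ∪ B)) ∧ subsetEqᵇ (Asc c) B)))

  if-then-0 : (b : Bool) (f : Subset n → ℕ) → sumOver (λ B → if b then f B else 0) Bs ≡ (if b then sumOver f Bs else 0)
  if-then-0 true  f = refl
  if-then-0 false f = sumOver-zero Bs

  does-≟-true : (b : Bool) → does (b Data.Bool.≟ true) ≡ b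
  does-≟-true false = refl
  does-≟-true true  = refl

  nested-if : (a b s : Bool) → (if a then (if b then ind s else 0) else 0) ≡ ind (s ∧ (a ∧ b))
  nested-if true  true  s     = sym (cong ind (∧-identityʳ s))
  nested-if true  false s     = sym (cong ind (∧-zeroʳ s))
  nested-if false b     s     = sym (cong ind (∧-zeroʳ s))

  multiplicity : ∀ c → sumOver (λ A → sumOver (λ B → counted A B c) Bs) As ≡ ind (surjᵇ c ∧ compatibleᵇ π c)
  multiplicity c = begin
    sumOver (λ A → sumOver (λ B → counted A B c) Bs) As
      ≡⟨ sumOver-cong (λ A → trans (sumOver-cong (wordeuler-indicator c A) Bs)
                                   (if-then-0 (subsetEqᵇ (Des c) A) _)) As ⟩
    sumOver (λ A → if subsetEqᵇ (Des c) A then sumOver (λ B → if subsetEqᵇ (Asc c) B then ind (surjᵇ c) else 0) Bs else 0) As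
      ≡⟨ sumOver-cong (λ A → cong (λ s → if subsetEqᵇ (Des c) A then s else 0) (sumOver-δ-filter n (Asc c) outY₂ _)) As ⟩
    sumOver (λ A → if subsetEqᵇ (Des c) A then (if does (outY₂ (Asc c)) then ind (surjᵇ c) else 0) else 0) As
      ≡⟨ sumOver-δ-filter n (Des c) inY₂ _ ⟩
    (if does (inY₂ (Des c)) then (if does (outY₂ (Asc c)) then ind (surjᵇ c) else 0) else 0)
      ≡⟨ cong₂ (λ a b → if a then (if b then ind (surjᵇ c) else 0) else 0)
               (does-≟-true (subsetLeqᵇ (Des c) (Y2 π))) (does-≟-true (subsetLeqᵇ (Asc c) (∁ (Y2 π)))) ⟩
    (if subsetLeqᵇ (Des c) (Y2 π) then (if subsetLeqᵇ (Asc c) (∁ (Y2 π)) then ind (surjᵇ c) else 0) else 0)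
      ≡⟨ nested-if (subsetLeqᵇ (Des c) (Y2 π)) (subsetLeqᵇ (Asc c) (∁ (Y2 π))) (surjᵇ c) ⟩
    ind (surjᵇ c ∧ compatibleᵇ π c) ∎

okᵇ : Sign → ℕ → ℕ → Bool
okᵇ plus  a b = not (b <ᵇ a)
okᵇ minus a b = not (a <ᵇ b)

compatibleᵇ-∷ : {k n : ℕ} (s : Sign) (π : Vec Sign n) (a b : Fin k) (rest : Vec (Fin k) n) →
  compatibleᵇ (s ∷ π) (a ∷ b ∷ rest) ≡ okᵇ s (toℕ a) (toℕ b) ∧ compatibleᵇ π (b ∷ rest)
compatibleᵇ-∷ plus  π a b rest = regroup (toℕ b <ᵇ toℕ a) (toℕ a <ᵇ toℕ b) _ _
  where
  regroup : (x y p q : Bool) → ((if x then false else true) ∧ p) ∧ ((if y then true else true) ∧ q) ≡ not x ∧ (p ∧ q)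
  regroup true  y     p q = refl
  regroup false true  p q = refl
  regroup false false p q = refl
compatibleᵇ-∷ minus π a b rest = regroup (toℕ b <ᵇ toℕ a) (toℕ a <ᵇ toℕ b) _ _
  where
  regroup : (x y p q : Bool) → ((if x then true else true) ∧ p) ∧ ((if y then false else true) ∧ q) ≡ not y ∧ (p ∧ q)
  regroup true  true  p q = ∧-zeroʳ p
  regroup false true  p q = ∧-zeroʳ p
  regroup true  false p q = refl
  regroup false false p q = refl

-- The i-th colour of a word given as a list (0-based; out of range gives colour 0).
colourAt : {k : ℕ} → List (Fin (suc k)) → ℕ → Fin (suc k)
colourAt []       _       = Fin.zero
colourAt (x ∷ xs) zero    = x
colourAt (x ∷ xs) (suc i) = colourAt xs i

-- Compatibility stated position by position, the form produced by the web-diagram analysis.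
Compatible : {k : ℕ} → ℕ → List Sign → List (Fin (suc k)) → Set
Compatible n sπ cs = ∀ i → i < n → T (okᵇ (signAt sπ i) (toℕ (colourAt cs i)) (toℕ (colourAt cs (suc i))))

compatibleᵇ⇔Compatible : {k n : ℕ} (π : Vec Sign n) (c : Vec (Fin (suc k)) (suc n)) →
  T (compatibleᵇ π c) ⇔ Compatible n (toList π) (toList c)
compatibleᵇ⇔Compatible []      (a ∷ [])       = mk⇔ (λ _ _ ()) _
compatibleᵇ⇔Compatible {n = suc n} (s ∷ π) (a ∷ b ∷ rest) = begin
  T (compatibleᵇ (s ∷ π) (a ∷ b ∷ rest))
    ≡⟨ cong T (compatibleᵇ-∷ s π a b rest) ⟩
  T (okᵇ s (toℕ a) (toℕ b) ∧ compatibleᵇ π (b ∷ rest))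
    ≈⟨ T-∧ ⟩
  (T (okᵇ s (toℕ a) (toℕ b)) × T (compatibleᵇ π (b ∷ rest)))
    ≈⟨ ⇔-id _ ×-⇔ compatibleᵇ⇔Compatible π (b ∷ rest) ⟩
  (T (okᵇ s (toℕ a) (toℕ b)) × Compatible n (toList π) (toList (b ∷ rest)))
    ≈⟨ mk⇔ cons uncons ⟩
  Compatible (suc n) (toList (s ∷ π)) (toList (a ∷ b ∷ rest)) ∎
  where
  open SetoidReasoning (⇔-setoid 0ℓ)
  cons : T (okᵇ s (toℕ a) (toℕ b)) × Compatible n (toList π) (toList (b ∷ rest)) →
    Compatible (suc n) (toList (s ∷ π)) (toList (a ∷ b ∷ rest))
  cons (here , there) zero    _         = here
  cons (here , there) (suc i) (s≤s i<n) = there i i<n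
  uncons : Compatible (suc n) (toList (s ∷ π)) (toList (a ∷ b ∷ rest)) →
    T (okᵇ s (toℕ a) (toℕ b)) × Compatible n (toList π) (toList (b ∷ rest))
  uncons all = all zero (s≤s z≤n) , λ i i<n → all (suc i) (s≤s i<n)

endpointCount : ((ℕ × ℕ) → Bool) → Edge → ℕ
endpointCount P d = count P (endpoints (d ∷ []))

count-++ : {A : Set} (p : A → Bool) (xs ys : List A) → count p (xs ++ ys) ≡ count p xs + count p ys
count-++ p []       ys = refl
count-++ p (x ∷ xs) ys with p x
... | true  = cong suc (count-++ p xs ys)
... | false = count-++ p xs ys

count-endpoints : (P : (ℕ × ℕ) → Bool) (X : List Edge) → count P (endpoints X) ≡ sumOver (endpointCount P) X
count-endpoints P []      = refl
count-endpoints P (d ∷ X) =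
  trans (count-++ P (endpoints (d ∷ [])) (endpoints X)) (cong (endpointCount P d +_) (count-endpoints P X))

onPeg : Edge → ℕ → ℕ
onPeg d p = endpointCount (λ q → proj₁ q ≡ᵇ p) d

pegCount-++ : (p : ℕ) (X Y : List Edge) → pegCount p (X ++ Y) ≡ pegCount p X + pegCount p Y
pegCount-++ p X Y = begin
  pegCount p (X ++ Y)                                   ≡⟨ count-endpoints _ (X ++ Y) ⟩
  sumOver (λ d → onPeg d p) (X ++ Y)                    ≡⟨ sumOver-++ _ X Y ⟩
  sumOver (λ d → onPeg d p) X + sumOver (λ d → onPeg d p) Y ≡⟨ cong₂ _+_ (count-endpoints _ X) (count-endpoints _ Y) ⟨
  pegCount p X + pegCount p Y ∎
  where open ≡-Reasoning

pegCount-map : (p : ℕ) (f : Edge → Edge) → (∀ d → onPeg (f d) p ≡ onPeg d p) →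
  (X : List Edge) → pegCount p (map f X) ≡ pegCount p X
pegCount-map p f keepsPegs X = begin
  pegCount p (map f X)                  ≡⟨ count-endpoints _ (map f X) ⟩
  sumOver (λ d → onPeg d p) (map f X)   ≡⟨ sumOver-map _ f X ⟩
  sumOver (λ d → onPeg (f d) p) X       ≡⟨ sumOver-cong keepsPegs X ⟩
  sumOver (λ d → onPeg d p) X           ≡⟨ count-endpoints _ X ⟨
  pegCount p X ∎
  where open ≡-Reasoning

data Run (ℓ : ℕ) : ℕ → List (Fin ℓ) → Set where
  done : Run ℓ ℓ []
  next : {k : ℕ} {m : Fin ℓ} {L : List (Fin ℓ)} → toℕ m ≡ k → Run ℓ (suc k) L → Run ℓ k (m ∷ L)

run-tabulate : {ℓ n : ℕ} (f : Fin n → Fin ℓ) (k : ℕ) → (∀ i → toℕ (f i) ≡ k + toℕ i) → k + n ≡ ℓ →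
  Run ℓ k (tabulate f)
run-tabulate {n = zero}  f k _     k+0≡ℓ rewrite +-identityʳ k | k+0≡ℓ = done
run-tabulate {n = suc n} f k f≡k+i k+n≡ℓ =
  next (trans (f≡k+i Fin.zero) (+-identityʳ k))
       (run-tabulate (f ∘ Fin.suc) (suc k) (λ i → trans (f≡k+i (Fin.suc i)) (+-suc k (toℕ i)))
                     (trans (sym (+-suc k n)) k+n≡ℓ))

run-allFin : (ℓ : ℕ) → Run ℓ 0 (allFin ℓ)
run-allFin ℓ = run-tabulate (λ i → i) 0 (λ i → refl) refl

split-<-suc : (a k e : ℕ) → (if a <ᵇ k then e else 0) + (if a ≡ᵇ k then e else 0) ≡ (if a <ᵇ suc k then e else 0)
split-<-suc zero    zero    e = refl
split-<-suc zero    (suc k) e = +-identityʳ e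
split-<-suc (suc a) zero    e = refl
split-<-suc (suc a) (suc k) e = split-<-suc a k e

-- The reconstruction R(D, c) of an arbitrary diagram, described edge by edge:
-- an edge d of colour m reappears as φ (d , m), with each endpoint lifted to its
-- rank inside the colour class of m plus the number of endpoints on the same peg
-- carried by edges of smaller colour.
module Reconstruction (ℓ : ℕ) (D : List Edge) (c : Vec (Fin ℓ) (length D)) where

  Z : List (Edge × Fin ℓ)
  Z = zip D (toList c)

  hasColour : (m : Fin ℓ) → Decidable (λ (dm : Edge × Fin ℓ) → toℕ (proj₂ dm) ≡ toℕ m)
  hasColour m dm = toℕ (proj₂ dm) Data.Nat.≟ toℕ m

  class : Fin ℓ → List Edge
  class m = colourClass D c m

  below : ℕ → ℕ → ℕ
  below k p = sumOver (λ dm → if toℕ (proj₂ dm) <ᵇ k then onPeg (proj₁ dm) p else 0) Z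

  φ : Edge × Fin ℓ → Edge
  φ ((x , y , a , b) , m) = (x , y , rank (class m) x a + below (toℕ m) x , rank (class m) y b + below (toℕ m) y)

  count-class : (P : (ℕ × ℕ) → Bool) (m : Fin ℓ) →
    count P (endpoints (class m)) ≡ sumOver (λ dm → if toℕ (proj₂ dm) ≡ᵇ toℕ m then endpointCount P (proj₁ dm) else 0) Z
  count-class P m = begin
    count P (endpoints (class m))
      ≡⟨ count-endpoints P (class m) ⟩
    sumOver (endpointCount P) (map proj₁ (filter (hasColour m) Z))
      ≡⟨ sumOver-map (endpointCount P) proj₁ (filter (hasColour m) Z) ⟩
    sumOver (endpointCount P ∘ proj₁) (filter (hasColour m) Z)
      ≡⟨ sumOver-filter (hasColour m) (endpointCount P ∘ proj₁) Z ⟩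
    sumOver (λ dm → if toℕ (proj₂ dm) ≡ᵇ toℕ m then endpointCount P (proj₁ dm) else 0) Z ∎
    where open ≡-Reasoning

  pegCount-step : (p : ℕ) (acc : List Edge) (m : Fin ℓ) →
    pegCount p (acc ⊕ rel (class m)) ≡ pegCount p acc + pegCount p (class m)
  pegCount-step p acc m = trans (pegCount-++ p acc _) (cong (pegCount p acc +_)
    (trans (pegCount-map p _ (λ { (x , y , a , b) → refl }) (rel (class m)))
           (pegCount-map p _ (λ { (x , y , a , b) → refl }) (class m))))

  record Invariant (k : ℕ) (acc : List Edge) : Set where
    field
      pegs     : ∀ p → pegCount p acc ≡ below k p
      sound    : ∀ e → e ∈ acc → ∃ λ dm → dm ∈ Z × e ≡ φ dm
      complete : ∀ dm → dm ∈ Z → toℕ (proj₂ dm) < k → φ dm ∈ acc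

  invariant-start : Invariant 0 []
  invariant-start = record { pegs = λ p → sym (sumOver-zero Z) ; sound = λ e () ; complete = λ dm _ () }

  invariant-step : (k : ℕ) (m : Fin ℓ) (acc : List Edge) → toℕ m ≡ k →
    Invariant k acc → Invariant (suc k) (acc ⊕ rel (class m))
  invariant-step k m acc refl inv = record { pegs = pegs′ ; sound = sound′ ; complete = complete′ }
    where
    open Invariant inv
    shifted : ∀ x y a b → (x , y , rank (class m) x a + pegCount x acc , rank (class m) y b + pegCount y acc)
                        ≡ φ ((x , y , a , b) , m)
    shifted x y a b = cong₂ (λ u v → (x , y , rank (class m) x a + u , rank (class m) y b + v)) (pegs x) (pegs y)

    pegs′ : ∀ p → pegCount p (acc ⊕ rel (class m)) ≡ below (suc k) p
    pegs′ p = begin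
      pegCount p (acc ⊕ rel (class m))        ≡⟨ pegCount-step p acc m ⟩
      pegCount p acc + pegCount p (class m)   ≡⟨ cong₂ _+_ (pegs p) (trans (count-class _ m) (sumOver-cong (λ _ → refl) Z)) ⟩
      below k p + sumOver (λ dm → if toℕ (proj₂ dm) ≡ᵇ k then onPeg (proj₁ dm) p else 0) Z
        ≡⟨ sumOver-+ (λ dm → if toℕ (proj₂ dm) <ᵇ k then onPeg (proj₁ dm) p else 0)
                   (λ dm → if toℕ (proj₂ dm) ≡ᵇ k then onPeg (proj₁ dm) p else 0) Z ⟨
      sumOver (λ dm → (if toℕ (proj₂ dm) <ᵇ k then onPeg (proj₁ dm) p else 0)
                    + (if toℕ (proj₂ dm) ≡ᵇ k then onPeg (proj₁ dm) p else 0)) Z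
        ≡⟨ sumOver-cong (λ dm → split-<-suc (toℕ (proj₂ dm)) k (onPeg (proj₁ dm) p)) Z ⟩
      below (suc k) p ∎
      where open ≡-Reasoning

    sound′ : ∀ e → e ∈ acc ⊕ rel (class m) → ∃ λ dm → dm ∈ Z × e ≡ φ dm
    sound′ e e∈ with ∈-++⁻ acc e∈
    ... | inj₁ e∈acc = sound e e∈acc
    ... | inj₂ e∈new with ∈-map⁻ _ e∈new
    ... | r , r∈ , refl with ∈-map⁻ _ r∈
    ... | (x , y , a , b) , d∈ , refl with ∈-map⁻ proj₁ d∈
    ... | (d , m′) , dm∈ , refl with ∈-filter⁻ (hasColour m) {xs = Z} dm∈
    ... | dm∈Z , colour≡ with toℕ-injective colour≡
    ... | refl = ((x , y , a , b) , m) , dm∈Z , shifted x y a b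

    complete′ : ∀ dm → dm ∈ Z → toℕ (proj₂ dm) < suc k → φ dm ∈ acc ⊕ rel (class m)
    complete′ dm dm∈ lt with toℕ (proj₂ dm) <? toℕ m
    ... | yes lt′ = ∈-++⁺ˡ (complete dm dm∈ lt′)
    ... | no  nlt with toℕ-injective {i = proj₂ dm} {j = m} (≤-antisym (≤-pred lt) (≮⇒≥ nlt))
    complete′ ((x , y , a , b) , .m) dm∈ lt | no nlt | refl =
      subst (_∈ acc ⊕ rel (class m)) (shifted x y a b)
        (∈-++⁺ʳ acc (∈-map⁺ _ (∈-map⁺ _ (∈-map⁺ proj₁ (∈-filter⁺ (hasColour m) dm∈ refl)))))

  invariant-fold : (k : ℕ) (L : List (Fin ℓ)) (acc : List Edge) → Run ℓ k L →
    Invariant k acc → Invariant ℓ (foldl _⊕_ acc (map (λ j → rel (class j)) L))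
  invariant-fold k []      acc done          inv = inv
  invariant-fold k (m ∷ L) acc (next m≡k run) inv =
    invariant-fold (suc k) L _ run (invariant-step k m acc m≡k inv)

  private
    final : Invariant ℓ (reconstruct D c)
    final = invariant-fold 0 (allFin ℓ) [] (run-allFin ℓ) invariant-start

  reconstruct-sound : ∀ e → e ∈ reconstruct D c → ∃ λ dm → dm ∈ Z × e ≡ φ dm
  reconstruct-sound = Invariant.sound final

  reconstruct-complete : ∀ dm → dm ∈ Z → φ dm ∈ reconstruct D c
  reconstruct-complete dm dm∈ = Invariant.complete final dm dm∈ (toℕ<n (proj₂ dm))

edgeEqᵇ-sound : (e e′ : Edge) → T (edgeEqᵇ e e′) → e ≡ e′
edgeEqᵇ-sound (x , y , a , b) (x′ , y′ , a′ , b′) eq =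
  let x≡ , eq₁ = Equivalence.to (T-∧ {x ≡ᵇ x′}) eq
      y≡ , eq₂ = Equivalence.to (T-∧ {y ≡ᵇ y′}) eq₁
      a≡ , b≡  = Equivalence.to (T-∧ {a ≡ᵇ a′}) eq₂
  in cong₂ _,_ (≡ᵇ⇒≡ x x′ x≡)
       (cong₂ _,_ (≡ᵇ⇒≡ y y′ y≡) (cong₂ _,_ (≡ᵇ⇒≡ a a′ a≡) (≡ᵇ⇒≡ b b′ b≡)))

edgeEqᵇ-refl : (e : Edge) → T (edgeEqᵇ e e)
edgeEqᵇ-refl (x , y , a , b) = Equivalence.from T-∧ (≡⇒≡ᵇ x x refl ,
  Equivalence.from T-∧ (≡⇒≡ᵇ y y refl , Equivalence.from T-∧ (≡⇒≡ᵇ a a refl , ≡⇒≡ᵇ b b refl)))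

memᵇ⇔∈ : (e : Edge) (X : List Edge) → T (memᵇ e X) ⇔ e ∈ X
memᵇ⇔∈ e X = mk⇔ (Any.map (edgeEqᵇ-sound e _) ∘ any⁻ _ X) (any⁺ _ ∘ Any.map (λ { refl → edgeEqᵇ-refl e }))

SameEdges : List Edge → List Edge → Set
SameEdges X Y = (∀ e → e ∈ X → e ∈ Y) × (∀ e → e ∈ Y → e ∈ X)

sameSet⇔ : (X Y : List Edge) → T (sameSet X Y) ⇔ SameEdges X Y
sameSet⇔ X Y = mk⇔ to from
  where
  to : T (sameSet X Y) → SameEdges X Y
  to t with Equivalence.to T-∧ t
  ... | X⊆Y , Y⊆X =
    (λ e e∈ → Equivalence.to (memᵇ⇔∈ e Y) (All.lookup (all⁺ _ X X⊆Y) e∈)) ,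
    (λ e e∈ → Equivalence.to (memᵇ⇔∈ e X) (All.lookup (all⁺ _ Y Y⊆X) e∈))
  from : SameEdges X Y → T (sameSet X Y)
  from (X⊆Y , Y⊆X) = Equivalence.from T-∧
    (all⁻ _ (All.tabulate (λ {e} e∈ → Equivalence.from (memᵇ⇔∈ e Y) (X⊆Y e e∈))) ,
     all⁻ _ (All.tabulate (λ {e} e∈ → Equivalence.from (memᵇ⇔∈ e X) (Y⊆X e e∈))))

Σ< : ℕ → (ℕ → ℕ) → ℕ
Σ< zero    w = 0
Σ< (suc N) w = w 0 + Σ< N (w ∘ suc)

sumOver-applyUpTo : {A : Set} (F : A → ℕ) (h : ℕ → A) (N : ℕ) → sumOver F (applyUpTo h N) ≡ Σ< N (F ∘ h)
sumOver-applyUpTo F h zero    = refl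
sumOver-applyUpTo F h (suc N) = cong (F (h 0) +_) (sumOver-applyUpTo F (h ∘ suc) N)

Σ<-cong : (N : ℕ) {w w′ : ℕ → ℕ} → (∀ j → w j ≡ w′ j) → Σ< N w ≡ Σ< N w′
Σ<-cong zero    w≡w′ = refl
Σ<-cong (suc N) w≡w′ = cong₂ _+_ (w≡w′ 0) (Σ<-cong N (w≡w′ ∘ suc))

Σ<-zero : (N : ℕ) → Σ< N (λ _ → 0) ≡ 0
Σ<-zero zero    = refl
Σ<-zero (suc N) = Σ<-zero N

Σ<-+ : (N : ℕ) (w w′ : ℕ → ℕ) → Σ< N (λ j → w j + w′ j) ≡ Σ< N w + Σ< N w′
Σ<-+ zero    w w′ = refl
Σ<-+ (suc N) w w′ = trans (cong (w 0 + w′ 0 +_) (Σ<-+ N (w ∘ suc) (w′ ∘ suc))) (interchange (w 0) (w′ 0) _ _)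

Σ<-δ : (N : ℕ) (w : ℕ → ℕ) (b : ℕ) → Σ< N (λ j → if j ≡ᵇ b then w j else 0) ≡ (if b <ᵇ N then w b else 0)
Σ<-δ zero    w b       = refl
Σ<-δ (suc N) w zero    = trans (cong (w 0 +_) (Σ<-zero N)) (+-identityʳ _)
Σ<-δ (suc N) w (suc b) = Σ<-δ N (w ∘ suc) b

<ᵇ-irrefl : (a : ℕ) → (a <ᵇ a) ≡ false
<ᵇ-irrefl zero    = refl
<ᵇ-irrefl (suc a) = <ᵇ-irrefl a

≡ᵇ-refl : (a : ℕ) → (a ≡ᵇ a) ≡ true
≡ᵇ-refl a = Equivalence.to T-≡ (≡⇒≡ᵇ a a refl)

<⇒<ᵇ≡true : {a b : ℕ} → a < b → (a <ᵇ b) ≡ true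
<⇒<ᵇ≡true a<b = Equivalence.to T-≡ (<⇒<ᵇ a<b)

<⇒≡ᵇ-false : {a b : ℕ} → a < b → (a ≡ᵇ b) ≡ false
<⇒≡ᵇ-false {zero}  {suc b} _         = refl
<⇒≡ᵇ-false {suc a} {suc b} (s≤s a<b) = <⇒≡ᵇ-false a<b

any≡nonzero-count : {A : Set} (p : A → Bool) (xs : List A) → any p xs ≡ not (count p xs ≡ᵇ 0)
any≡nonzero-count p []       = refl
any≡nonzero-count p (x ∷ xs) with p x
... | true  = refl
... | false = any≡nonzero-count p xs

endpointCount-edge : (P : (ℕ × ℕ) → Bool) (x y a b : ℕ) → endpointCount P (x , y , a , b) ≡ ind (P (x , a)) + ind (P (y , b))
endpointCount-edge P x y a b with P (x , a)
... | true  = refl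
... | false = refl

atPeg : ℕ → (ℕ → Bool) → (ℕ × ℕ) → Bool
atPeg p H q = (proj₁ q ≡ᵇ p) ∧ H (proj₂ q)

-- On a peg with one endpoint at height 1 (colour lo) and one at height 2 (colour hi),
-- the reconstruction lifts the lower one to 1 + [hi < lo] and the upper one to
-- 1 + [lo = hi] + [lo < hi]; either keeps its height iff lo ≤ hi.
lower-keeps-height : (lo hi : ℕ) → (suc (ind (hi <ᵇ lo)) ≡ 1) ⇔ T (not (hi <ᵇ lo))
lower-keeps-height lo hi with hi <ᵇ lo
... | true  = mk⇔ (λ ()) (λ ())
... | false = mk⇔ _ (λ _ → refl)

upper-keeps-height : (lo hi : ℕ) → (suc (ind (lo ≡ᵇ hi)) + ind (lo <ᵇ hi) ≡ 2) ⇔ T (not (hi <ᵇ lo))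
upper-keeps-height zero    zero     = mk⇔ _ (λ _ → refl)
upper-keeps-height zero    (suc hi) = mk⇔ _ (λ _ → refl)
upper-keeps-height (suc lo) zero    = mk⇔ (λ ()) (λ ())
upper-keeps-height (suc lo) (suc hi) = upper-keeps-height lo hi

length-webDiagram : {n : ℕ} (π : Vec Sign n) → length (webDiagram π) ≡ suc n
length-webDiagram {n} π = trans (length-map _ (upTo (suc n))) (length-upTo (suc n))

-- Edge e_{j+1}
-- (index j < n+1) joins peg j+1 at height x_{j+1} to peg j+2 at height y_{j+2};
-- every inner peg i+2 carries exactly the head of e_{i+1} and the tail of e_{i+2},
-- at heights {1, 2}, and the outer pegs carry one endpoint at height 1.
module WebDiagram {n k : ℕ} (π : Vec Sign n) (c : Vec (Fin (suc k)) (length (webDiagram π))) where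

  open Reconstruction (suc k) (webDiagram π) c

  N : ℕ
  N = suc n

  cs : List (Fin (suc k))
  cs = toList c

  colour : ℕ → ℕ
  colour j = toℕ (colourAt cs j)

  tailH headH : ℕ → ℕ
  tailH j = xCoord π (suc j)
  headH j = yCoord π (suc (suc j))

  edge : ℕ → Edge
  edge j = (suc j , suc (suc j) , tailH j , headH j)

  coloured : ℕ → Edge × Fin (suc k)
  coloured j = (edge j , colourAt cs j)

  Z≡ : Z ≡ applyUpTo coloured N
  Z≡ = zip-applyUpTo N (λ j → j) cs (trans (length-toList c) (length-webDiagram π))
    where
    zip-applyUpTo : (M : ℕ) (f : ℕ → ℕ) (xs : List (Fin (suc k))) → length xs ≡ M →
      zip (map edge (applyUpTo f M)) xs ≡ applyUpTo (λ j → (edge (f j) , colourAt xs j)) M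
    zip-applyUpTo zero    f []       _  = refl
    zip-applyUpTo (suc M) f (x ∷ xs) eq = cong ((edge (f 0) , x) ∷_) (zip-applyUpTo M (f ∘ suc) xs (suc-injective eq))

  sumOver-Z : (F : Edge × Fin (suc k) → ℕ) → sumOver F Z ≡ Σ< N (F ∘ coloured)
  sumOver-Z F = trans (cong (sumOver F) Z≡) (sumOver-applyUpTo F coloured N)

  -- Contributions to a count of endpoints on peg b+1 of the tail of e_{b+1} and of the head of e_b.
  tailTerm headTerm : (ℕ → Bool) → (ℕ → Bool) → ℕ → ℕ
  tailTerm C H b       = if b <ᵇ N then ind (C (colour b) ∧ H (tailH b)) else 0
  headTerm C H zero    = 0
  headTerm C H (suc b) = if b <ᵇ N then ind (C (colour b) ∧ H (headH b)) else 0

  pegSum : (C H : ℕ → Bool) (b : ℕ) →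
    sumOver (λ dm → if C (toℕ (proj₂ dm)) then endpointCount (atPeg (suc b) H) (proj₁ dm) else 0) Z
    ≡ tailTerm C H b + headTerm C H b
  pegSum C H b = begin
    sumOver (λ dm → if C (toℕ (proj₂ dm)) then endpointCount (atPeg (suc b) H) (proj₁ dm) else 0) Z
      ≡⟨ sumOver-Z _ ⟩
    Σ< N (λ j → if C (colour j) then endpointCount (atPeg (suc b) H) (edge j) else 0)
      ≡⟨ Σ<-cong N (λ j → trans (cong (λ t → if C (colour j) then t else 0)
                                      (endpointCount-edge (atPeg (suc b) H) (suc j) (suc (suc j)) (tailH j) (headH j)))
                                (distribute (C (colour j)) (j ≡ᵇ b) (suc j ≡ᵇ b) (H (tailH j)) (H (headH j)))) ⟩
    Σ< N (λ j → (if j ≡ᵇ b then ind (C (colour j) ∧ H (tailH j)) else 0)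
              + (if suc j ≡ᵇ b then ind (C (colour j) ∧ H (headH j)) else 0))
      ≡⟨ Σ<-+ N (λ j → if j ≡ᵇ b then ind (C (colour j) ∧ H (tailH j)) else 0)
                (λ j → if suc j ≡ᵇ b then ind (C (colour j) ∧ H (headH j)) else 0) ⟩
    Σ< N (λ j → if j ≡ᵇ b then ind (C (colour j) ∧ H (tailH j)) else 0)
      + Σ< N (λ j → if suc j ≡ᵇ b then ind (C (colour j) ∧ H (headH j)) else 0)
      ≡⟨ cong₂ _+_ (Σ<-δ N (λ j → ind (C (colour j) ∧ H (tailH j))) b) (head-δ b) ⟩
    tailTerm C H b + headTerm C H b ∎
    where
    open ≡-Reasoning
    distribute : (c e₁ e₂ u v : Bool) → (if c then ind (e₁ ∧ u) + ind (e₂ ∧ v) else 0)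
                 ≡ (if e₁ then ind (c ∧ u) else 0) + (if e₂ then ind (c ∧ v) else 0)
    distribute true  e₁    e₂    u v = cong₂ _+_ (lemma e₁) (lemma e₂)
      where
      lemma : (e : Bool) {w : Bool} → ind (e ∧ w) ≡ (if e then ind w else 0)
      lemma true  = refl
      lemma false = refl
    distribute false true  true  u v = refl
    distribute false true  false u v = refl
    distribute false false true  u v = refl
    distribute false false false u v = refl
    head-δ : ∀ b → Σ< N (λ j → if suc j ≡ᵇ b then ind (C (colour j) ∧ H (headH j)) else 0) ≡ headTerm C H b
    head-δ zero    = Σ<-zero N
    head-δ (suc b) = Σ<-δ N (λ j → ind (C (colour j) ∧ H (headH j))) b

  below-peg : (kk b : ℕ) → below kk (suc b) ≡ tailTerm (_<ᵇ kk) (λ _ → true) b + headTerm (_<ᵇ kk) (λ _ → true) b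
  below-peg kk b = trans
    (sumOver-cong (λ dm → cong (λ t → if toℕ (proj₂ dm) <ᵇ kk then t else 0)
                               (count-cong (λ q → sym (∧-identityʳ (proj₁ q ≡ᵇ suc b))) (endpoints (proj₁ dm ∷ [])))) Z)
    (pegSum (_<ᵇ kk) (λ _ → true) b)

  occupied-peg : (m : Fin (suc k)) (b h : ℕ) →
    occupied (class m) (suc b) h ≡ not (tailTerm (_≡ᵇ toℕ m) (_≡ᵇ h) b + headTerm (_≡ᵇ toℕ m) (_≡ᵇ h) b ≡ᵇ 0)
  occupied-peg m b h = trans (any≡nonzero-count _ (endpoints (class m)))
    (cong (λ t → not (t ≡ᵇ 0)) (trans (count-class (atPeg (suc b) (_≡ᵇ h)) m) (pegSum (_≡ᵇ toℕ m) (_≡ᵇ h) b)))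

  -- All heights in D_π are positive, so no endpoint sits at height 0.
  unoccupied-0 : (m : Fin (suc k)) (b : ℕ) → occupied (class m) (suc b) 0 ≡ false
  unoccupied-0 m b = trans (occupied-peg m b 0) (cong (λ t → not (t ≡ᵇ 0)) (cong₂ _+_ (tail-0 b) (head-0 b)))
    where
    tailH≢0 : ∀ j → (tailH j ≡ᵇ 0) ≡ false
    tailH≢0 zero    = refl
    tailH≢0 (suc j) with signAt (toList π) j
    ... | plus  = refl
    ... | minus = refl
    headH≢0 : ∀ j → (headH j ≡ᵇ 0) ≡ false
    headH≢0 j with j ≡ᵇ n
    ... | true  = refl
    ... | false with signAt (toList π) j
    ...   | plus  = refl
    ...   | minus = refl
    vanish : (guard : Bool) (x : Bool) {y : Bool} → y ≡ false → (if guard then ind (x ∧ y) else 0) ≡ 0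
    vanish true  x refl = cong ind (∧-zeroʳ x)
    vanish false x _    = refl
    tail-0 : ∀ b → tailTerm (_≡ᵇ toℕ m) (_≡ᵇ 0) b ≡ 0
    tail-0 b = vanish (b <ᵇ N) (colour b ≡ᵇ toℕ m) (tailH≢0 b)
    head-0 : ∀ b → headTerm (_≡ᵇ toℕ m) (_≡ᵇ 0) b ≡ 0
    head-0 zero    = refl
    head-0 (suc b) = vanish (b <ᵇ N) (colour b ≡ᵇ toℕ m) (headH≢0 b)

  rank-1 : (m : Fin (suc k)) (b : ℕ) → rank (class m) (suc b) 1 ≡ 1
  rank-1 m b rewrite unoccupied-0 m b = refl

  rank-2 : (m : Fin (suc k)) (b : ℕ) → rank (class m) (suc b) 2 ≡ suc (ind (occupied (class m) (suc b) 1))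
  rank-2 m b rewrite unoccupied-0 m b with occupied (class m) (suc b) 1
  ... | true  = refl
  ... | false = refl

  inner-peg-terms : (C H : ℕ → Bool) (i : ℕ) → i < n →
    tailTerm C H (suc i) + headTerm C H (suc i) ≡ ind (C (colour (suc i)) ∧ H (tailH (suc i))) + ind (C (colour i) ∧ H (headH i))
  inner-peg-terms C H i i<n rewrite <⇒<ᵇ≡true {suc i} {N} (s≤s i<n) | <⇒<ᵇ≡true {i} {N} (m<n⇒m<1+n i<n) = refl

  below-inner : (kk i : ℕ) → i < n → below kk (suc (suc i)) ≡ ind (colour (suc i) <ᵇ kk) + ind (colour i <ᵇ kk)
  below-inner kk i i<n = trans (below-peg kk (suc i)) (trans (inner-peg-terms (_<ᵇ kk) (λ _ → true) i i<n)
    (cong₂ _+_ (cong ind (∧-identityʳ (colour (suc i) <ᵇ kk))) (cong ind (∧-identityʳ (colour i <ᵇ kk)))))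

  occupied-inner : (m : Fin (suc k)) (i : ℕ) → i < n →
    occupied (class m) (suc (suc i)) 1 ≡ ((colour (suc i) ≡ᵇ toℕ m) ∧ (tailH (suc i) ≡ᵇ 1)) ∨ ((colour i ≡ᵇ toℕ m) ∧ (headH i ≡ᵇ 1))
  occupied-inner m i i<n = trans (occupied-peg m (suc i) 1)
    (trans (cong (λ t → not (t ≡ᵇ 0)) (inner-peg-terms (_≡ᵇ toℕ m) (_≡ᵇ 1) i i<n))
           (nonzero-sum ((colour (suc i) ≡ᵇ toℕ m) ∧ (tailH (suc i) ≡ᵇ 1)) ((colour i ≡ᵇ toℕ m) ∧ (headH i ≡ᵇ 1))))
    where
    nonzero-sum : (x y : Bool) → not (ind x + ind y ≡ᵇ 0) ≡ x ∨ y
    nonzero-sum true  y     = refl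
    nonzero-sum false true  = refl
    nonzero-sum false false = refl

  data Shape (i : ℕ) : Set where
    rising  : signAt (toList π) i ≡ plus  → tailH (suc i) ≡ 2 → headH i ≡ 1 → Shape i
    falling : signAt (toList π) i ≡ minus → tailH (suc i) ≡ 1 → headH i ≡ 2 → Shape i

  shape : (i : ℕ) → i < n → Shape i
  shape i i<n with signAt (toList π) i in sign≡
  ... | plus  = rising  sign≡ (tail-height sign≡) (head-height sign≡)
    where
    tail-height : signAt (toList π) i ≡ plus → tailH (suc i) ≡ 2
    tail-height s≡ rewrite s≡ = refl
    head-height : signAt (toList π) i ≡ plus → headH i ≡ 1
    head-height s≡ rewrite <⇒≡ᵇ-false i<n | s≡ = refl
  ... | minus = falling sign≡ (tail-height sign≡) (head-height sign≡)
    where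
    tail-height : signAt (toList π) i ≡ minus → tailH (suc i) ≡ 1
    tail-height s≡ rewrite s≡ = refl
    head-height : signAt (toList π) i ≡ minus → headH i ≡ 2
    head-height s≡ rewrite <⇒≡ᵇ-false i<n | s≡ = refl

  newTail newHead : ℕ → ℕ
  newTail j = rank (class (colourAt cs j)) (suc j) (tailH j) + below (colour j) (suc j)
  newHead j = rank (class (colourAt cs j)) (suc (suc j)) (headH j) + below (colour j) (suc (suc j))

  okAt : ℕ → Bool
  okAt i = okᵇ (signAt (toList π) i) (colour i) (colour (suc i))

  module InnerPeg (i : ℕ) (i<n : i < n) where
    open ≡-Reasoning
    ma mb : Fin (suc k)
    ma = colourAt cs i
    mb = colourAt cs (suc i)
    a b : ℕ
    a = colour i
    b = colour (suc i)

    occupied-1 : (m : Fin (suc k)) {t h : ℕ} → tailH (suc i) ≡ t → headH i ≡ h →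
      occupied (class m) (suc (suc i)) 1 ≡ ((b ≡ᵇ toℕ m) ∧ (t ≡ᵇ 1)) ∨ ((a ≡ᵇ toℕ m) ∧ (h ≡ᵇ 1))
    occupied-1 m refl refl = occupied-inner m i i<n

    rising-tail : tailH (suc i) ≡ 2 → headH i ≡ 1 → newTail (suc i) ≡ suc (ind (a ≡ᵇ b)) + ind (a <ᵇ b)
    rising-tail t≡ h≡ = begin
      newTail (suc i)
        ≡⟨ cong (λ h → rank (class mb) (suc (suc i)) h + below b (suc (suc i))) t≡ ⟩
      rank (class mb) (suc (suc i)) 2 + below b (suc (suc i))
        ≡⟨ cong₂ _+_ (rank-2 mb (suc i)) (below-inner b i i<n) ⟩
      suc (ind (occupied (class mb) (suc (suc i)) 1)) + (ind (b <ᵇ b) + ind (a <ᵇ b))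
        ≡⟨ cong₂ (λ o l → suc (ind o) + (ind l + ind (a <ᵇ b))) (occupied-1 mb t≡ h≡) (<ᵇ-irrefl b) ⟩
      suc (ind (((b ≡ᵇ b) ∧ false) ∨ ((a ≡ᵇ b) ∧ true))) + ind (a <ᵇ b)
        ≡⟨ cong (λ o → suc (ind o) + ind (a <ᵇ b)) (cong₂ _∨_ (∧-zeroʳ (b ≡ᵇ b)) (∧-identityʳ (a ≡ᵇ b))) ⟩
      suc (ind (a ≡ᵇ b)) + ind (a <ᵇ b) ∎

    rising-head : headH i ≡ 1 → newHead i ≡ suc (ind (b <ᵇ a))
    rising-head h≡ = begin
      newHead i
        ≡⟨ cong₂ _+_ (trans (cong (rank (class ma) (suc (suc i))) h≡) (rank-1 ma (suc i))) (below-inner a i i<n) ⟩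
      1 + (ind (b <ᵇ a) + ind (a <ᵇ a))
        ≡⟨ cong (λ l → suc (ind (b <ᵇ a) + ind l)) (<ᵇ-irrefl a) ⟩
      suc (ind (b <ᵇ a) + 0)
        ≡⟨ cong suc (+-identityʳ _) ⟩
      suc (ind (b <ᵇ a)) ∎

    falling-tail : tailH (suc i) ≡ 1 → newTail (suc i) ≡ suc (ind (a <ᵇ b))
    falling-tail t≡ = begin
      newTail (suc i)
        ≡⟨ cong₂ _+_ (trans (cong (rank (class mb) (suc (suc i))) t≡) (rank-1 mb (suc i))) (below-inner b i i<n) ⟩
      1 + (ind (b <ᵇ b) + ind (a <ᵇ b))
        ≡⟨ cong (λ l → suc (ind l + ind (a <ᵇ b))) (<ᵇ-irrefl b) ⟩
      suc (ind (a <ᵇ b)) ∎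

    falling-head : tailH (suc i) ≡ 1 → headH i ≡ 2 → newHead i ≡ suc (ind (b ≡ᵇ a)) + ind (b <ᵇ a)
    falling-head t≡ h≡ = begin
      newHead i
        ≡⟨ cong (λ h → rank (class ma) (suc (suc i)) h + below a (suc (suc i))) h≡ ⟩
      rank (class ma) (suc (suc i)) 2 + below a (suc (suc i))
        ≡⟨ cong₂ _+_ (rank-2 ma (suc i)) (below-inner a i i<n) ⟩
      suc (ind (occupied (class ma) (suc (suc i)) 1)) + (ind (b <ᵇ a) + ind (a <ᵇ a))
        ≡⟨ cong₂ (λ o l → suc (ind o) + (ind (b <ᵇ a) + ind l)) (occupied-1 ma t≡ h≡) (<ᵇ-irrefl a) ⟩
      suc (ind (((b ≡ᵇ a) ∧ true) ∨ ((a ≡ᵇ a) ∧ false))) + (ind (b <ᵇ a) + 0)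
        ≡⟨ cong₂ (λ o l → suc (ind o) + l) (trans (cong₂ _∨_ (∧-identityʳ (b ≡ᵇ a)) (∧-zeroʳ (a ≡ᵇ a))) (∨-identityʳ _))
                                              (+-identityʳ _) ⟩
      suc (ind (b ≡ᵇ a)) + ind (b <ᵇ a) ∎

    keeps : {new value h target : ℕ} {s : Sign} → new ≡ value → h ≡ target → signAt (toList π) i ≡ s →
      (value ≡ target) ⇔ T (okᵇ s a b) → (new ≡ h) ⇔ T (okAt i)
    keeps refl refl refl keeps-value = keeps-value

    inner-peg : ((newTail (suc i) ≡ tailH (suc i)) ⇔ T (okAt i)) × ((newHead i ≡ headH i) ⇔ T (okAt i))
    inner-peg with shape i i<n
    ... | rising s≡ t≡ h≡ =
      keeps (rising-tail t≡ h≡) t≡ s≡ (upper-keeps-height a b) , keeps (rising-head h≡) h≡ s≡ (lower-keeps-height a b)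
    ... | falling s≡ t≡ h≡ =
      keeps (falling-tail t≡) t≡ s≡ (lower-keeps-height b a) , keeps (falling-head t≡ h≡) h≡ s≡ (upper-keeps-height b a)

  inner-peg : (i : ℕ) → i < n →
    ((newTail (suc i) ≡ tailH (suc i)) ⇔ T (okAt i)) × ((newHead i ≡ headH i) ⇔ T (okAt i))
  inner-peg = InnerPeg.inner-peg

  -- The outer pegs carry a single endpoint, which stays at height 1.
  first-tail : newTail 0 ≡ tailH 0
  first-tail = cong₂ _+_ (rank-1 (colourAt cs 0) 0)
    (trans (below-peg (colour 0) 0) (cong (λ l → ind (l ∧ true) + 0) (<ᵇ-irrefl (colour 0))))

  last-head : newHead n ≡ headH n
  last-head rewrite ≡ᵇ-refl n = cong₂ _+_ (rank-1 (colourAt cs n) (suc n)) (begin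
    below (colour n) (suc (suc n))
      ≡⟨ below-peg (colour n) (suc n) ⟩
    (if suc n <ᵇ N then ind ((colour (suc n) <ᵇ colour n) ∧ true) else 0)
      + (if n <ᵇ N then ind ((colour n <ᵇ colour n) ∧ true) else 0)
      ≡⟨ cong₂ (λ g l → (if g then ind ((colour (suc n) <ᵇ colour n) ∧ true) else 0) + (if n <ᵇ N then ind (l ∧ true) else 0))
               (<ᵇ-irrefl n) (<ᵇ-irrefl (colour n)) ⟩
    (if n <ᵇ N then 0 else 0)
      ≡⟨ cong (λ g → if g then 0 else 0) (<⇒<ᵇ≡true (n<1+n n)) ⟩
    0 ∎)
    where open ≡-Reasoning

  all-fixed⇔Compatible : (∀ j → j < N → φ (coloured j) ≡ edge j) ⇔ Compatible n (toList π) cs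
  all-fixed⇔Compatible = mk⇔ to from
    where
    to : (∀ j → j < N → φ (coloured j) ≡ edge j) → Compatible n (toList π) cs
    to fixed i i<n = Equivalence.to (proj₂ (inner-peg i i<n))
      (cong (proj₂ ∘ proj₂ ∘ proj₂) (fixed i (m<n⇒m<1+n i<n)))
    from : Compatible n (toList π) cs → ∀ j → j < N → φ (coloured j) ≡ edge j
    from compatible j j<N = cong₂ (λ u v → (suc j , suc (suc j) , u , v)) (tail-ok j j<N) (head-ok j j<N)
      where
      tail-ok : ∀ j → j < N → newTail j ≡ tailH j
      tail-ok zero    _         = first-tail
      tail-ok (suc i) (s≤s i<n) = Equivalence.from (proj₁ (inner-peg i i<n)) (compatible i i<n)
      head-ok : ∀ j → j < N → newHead j ≡ headH j
      head-ok j (s≤s j≤n) with m≤n⇒m<n∨m≡n j≤n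
      ... | inj₁ j<n  = Equivalence.from (proj₂ (inner-peg j j<n)) (compatible j j<n)
      ... | inj₂ refl = last-head

  sameSet⇔all-fixed : T (sameSet (reconstruct (webDiagram π) c) (webDiagram π)) ⇔ (∀ j → j < N → φ (coloured j) ≡ edge j)
  sameSet⇔all-fixed = mk⇔ to from ⇔-∘ sameSet⇔ R D
    where
    R D : List Edge
    R = reconstruct (webDiagram π) c
    D = webDiagram π

    edge∈D : ∀ j → j < N → edge j ∈ D
    edge∈D j j<N = ∈-map⁺ edge (∈-upTo⁺ j<N)

    D-edges : ∀ d → d ∈ D → ∃ λ j → j < N × d ≡ edge j
    D-edges d d∈ with ∈-map⁻ edge d∈
    ... | j , j∈ , d≡ = j , ∈-upTo⁻ j∈ , d≡

    coloured∈Z : ∀ j → j < N → coloured j ∈ Z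
    coloured∈Z j j<N = subst (coloured j ∈_) (sym Z≡) (∈-applyUpTo⁺ coloured j<N)

    Z-elements : ∀ dm → dm ∈ Z → ∃ λ j → j < N × dm ≡ coloured j
    Z-elements dm dm∈ = ∈-applyUpTo⁻ coloured (subst (dm ∈_) Z≡ dm∈)

    to : SameEdges R D → ∀ j → j < N → φ (coloured j) ≡ edge j
    to (R⊆D , _) j j<N with D-edges _ (R⊆D _ (reconstruct-complete (coloured j) (coloured∈Z j j<N)))
    ... | j′ , _ , φ≡ with suc-injective (cong proj₁ φ≡)
    ... | refl = φ≡

    from : (∀ j → j < N → φ (coloured j) ≡ edge j) → SameEdges R D
    from fixed = R⊆D , D⊆R
      where
      R⊆D : ∀ e → e ∈ R → e ∈ D
      R⊆D e e∈ with reconstruct-sound e e∈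
      ... | dm , dm∈ , refl with Z-elements dm dm∈
      ... | j , j<N , refl = subst (_∈ D) (sym (fixed j j<N)) (edge∈D j j<N)
      D⊆R : ∀ e → e ∈ D → e ∈ R
      D⊆R e e∈ with D-edges e e∈
      ... | j , j<N , refl = subst (_∈ R) (fixed j j<N) (reconstruct-complete (coloured j) (coloured∈Z j j<N))

  reconstruct⇔Compatible : T (sameSet (reconstruct (webDiagram π) c) (webDiagram π)) ⇔ Compatible n (toList π) (toList c)
  reconstruct⇔Compatible = all-fixed⇔Compatible ⇔-∘ sameSet⇔all-fixed

T-injective : {a b : Bool} → T a ⇔ T b → a ≡ b
T-injective {false} {false} _   = refl
T-injective {false} {true}  a⇔b = ⊥-elim (Equivalence.from a⇔b tt)
T-injective {true}  {false} a⇔b = ⊥-elim (Equivalence.to a⇔b tt)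
T-injective {true}  {true}  _   = refl

count-allVecs-resize : {A : Set} (xs : List A) {m m′ : ℕ} (m≡m′ : m ≡ m′) (p : Vec A m → Bool) →
  count p (allVecs xs m) ≡ count (p ∘ subst (Vec A) (sym m≡m′)) (allVecs xs m′)
count-allVecs-resize xs refl p = refl

toList-subst : {A : Set} {m m′ : ℕ} (m≡m′ : m ≡ m′) (v : Vec A m) → toList (subst (Vec A) m≡m′ v) ≡ toList v
toList-subst refl v = refl

surjᵇ-toList : {ℓ m m′ : ℕ} (u : Vec (Fin ℓ) m) (v : Vec (Fin ℓ) m′) → toList u ≡ toList v → surjᵇ u ≡ surjᵇ v
surjᵇ-toList {ℓ} u v u≡v = cong (λ l → all (λ j → any (λ c′ → toℕ c′ ≡ᵇ toℕ j) l) (allFin ℓ)) u≡v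

fCount-web : (n k : ℕ) (π : Vec Sign n) → fCount (webDiagram π) (webDiagram π) (suc k) ≡ innerSum n (suc k) π
fCount-web n k π = begin
  fCount D D (suc k)
    ≡⟨ count-allVecs-resize (allFin (suc k)) (length-webDiagram π) _ ⟩
  count (λ v → surjᵇ (resize v) ∧ sameSet (reconstruct D (resize v)) D) Words
    ≡⟨ count-cong (λ v → cong₂ _∧_ (surjᵇ-toList (resize v) v (toList-resize v)) (fixes⇔compatible v)) Words ⟩
  count (λ v → surjᵇ v ∧ compatibleᵇ π v) Words
    ≡⟨ innerSum≡#compatible n (suc k) π ⟨
  innerSum n (suc k) π ∎
  where
  open ≡-Reasoning
  D : List Edge
  D = webDiagram π
  Words : List (Vec (Fin (suc k)) (suc n))
  Words = allVecs (allFin (suc k)) (suc n)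
  resize : Vec (Fin (suc k)) (suc n) → Vec (Fin (suc k)) (length D)
  resize = subst (Vec (Fin (suc k))) (sym (length-webDiagram π))
  toList-resize : ∀ v → toList (resize v) ≡ toList v
  toList-resize = toList-subst (sym (length-webDiagram π))
  fixes⇔compatible : ∀ v → sameSet (reconstruct D (resize v)) D ≡ compatibleᵇ π v
  fixes⇔compatible v = T-injective (⇔-sym (compatibleᵇ⇔Compatible π v) ⇔-∘ web)
    where
    web : T (sameSet (reconstruct D (resize v)) D) ⇔ Compatible n (toList π) (toList v)
    web = subst (λ l → T (sameSet (reconstruct D (resize v)) D) ⇔ Compatible n (toList π) l)
                (toList-resize v) (WebDiagram.reconstruct⇔Compatible π (resize v))

sumℚ-cong : (N : ℕ) {f g : ℕ → ℚ} → (∀ k → f k ≡ g k) → sumℚ N f ≡ sumℚ N g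
sumℚ-cong zero    f≡g = refl
sumℚ-cong (suc N) f≡g = cong₂ ℚ._+_ (sumℚ-cong N f≡g) (f≡g N)

corollary7p2 : (n : ℕ) → 1 ≤ n → (π : Vec Sign n) →
    Rcoef (webDiagram π) (webDiagram π) ≡ rhs n π
corollary7p2 n _ π = begin
  Rcoef D D
    ≡⟨ cong (λ L → sumℚ L (λ k → signedTerm k (fCount D D (suc k)))) (length-webDiagram π) ⟩
  sumℚ (suc n) (λ k → signedTerm k (fCount D D (suc k)))
    ≡⟨ sumℚ-cong (suc n) (λ k → cong (signedTerm k) (fCount-web n k π)) ⟩
  rhs n π ∎
  where
  open ≡-Reasoning
  D : List Edge
  D = webDiagram π
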